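{- Let $G$ be a finite bipartite graph with color classes $A$ and $B$, and let $b: V(G)\to\mathbb{Z}_{\ge 0}$. Then the binary relation $\le_A$ is a partial order on the set $\mathcal{C}$ of consistent $b$-flexible components of $G$.
   Context: For $v\in V(G)$, $\delta(v)$ denotes the set of edges incident with $v$. A $b$-matching is a set $M\subseteq E(G)$ with $|\delta(v)\cap M|\le b(v)$ for every $v$; it is maximum if it has the largest possible number of edges. A vertex $v$ is $M$-loose if $|\delta(v)\cap M|<b(v)$ and $M$-tight if equality holds. An edge is allowed if it lies in some maximum $b$-matching and forbidden otherwise; an allowed edge is inevitable if it lies in every maximum $b$-matching and flexible otherwise. A flexible component is an induced subgraph $G[V(K)]$ where $K$ is a connected component of the spanning subgraph $(V(G),\{\text{flexible edges}\})$; $\mathcal{F}$ denotes the set of flexible components (they partition $V(G)$). Let $\mathcal{D}$ be the set of vertices that are $M$-loose for some maximum $b$-matching $M$. A flexible component $C$ is loose if $V(C)\cap\mathcal{D}\neq\emptyset$. A vertex $v$ is inactive if $b(v)=0$; then $G[\{v\}]$ is a flexible component, called inactive. $C\in\mathcal{F}$ is inconsistent if it is loose, or it is inactive and its vertex has a neighbor in $\mathcal{D}$; otherwise $C$ is consistent. $\mathcal{C}$ denotes the set of consistent flexible components. For $W\in\{A,B\}$ let $\overline{W}$ be the other color class. For $C_1,C_2\in\mathcal{F}$ write $C_1\preceq^\circ_W C_2$ if $C_1=C_2$, or there is an inevitable edge joining a vertex of $V(C_1)\cap W$ to a vertex of $V(C_2)\cap\overline{W}$, or there is a forbidden edge joining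 a vertex of $V(C_2)\cap W$ to a vertex of $V(C_1)\cap\overline{W}$. For $C_1,C_2\in\mathcal{C}$, $C_1\le_W C_2$ means there exist $D_1,\dots,D_k\in\mathcal{C}$ ($k\ge1$) with $D_1=C_1$, $D_k=C_2$ and $D_i\preceq^\circ_W D_{i+1}$ for all $i<k$. -}

module Defs where

open import Data.Nat using (ℕ; zero; suc; _+_; _≤_; _<_)
open import Data.Fin using (Fin; _≟_)
import Data.Fin as F
open import Data.Bool using (Bool; true; false; if_then_else_)
open import Data.Sum using (_⊎_; inj₁; inj₂)
open import Data.Product using (Σ; ∃; _×_; _,_; proj₁)
open import Relation.Nullary using (¬_)
open import Relation.Nullary.Decidable using (⌊_⌋)
open import Relation.Binary.PropositionalEquality using (_≡_)
open import Relation.Binary.Construct.Closure.ReflexiveTransitive using (Star)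
open import Function.Definitions using (Injective)

-- A finite bipartite (multi)graph with colour classes A = Fin nA and
-- B = Fin nB; edge e joins the A-vertex (endA e) to the B-vertex (endB e).
record BGraph : Set where
  field
    nA nB m : ℕ
    endA : Fin m → Fin nA
    endB : Fin m → Fin nB

  V : Set
  V = Fin nA ⊎ Fin nB

  Edge : Set
  Edge = Fin m

Simple : BGraph → Set
Simple G = Injective _≡_ _≡_ (λ (e : BGraph.Edge G) → (BGraph.endA G e , BGraph.endB G e))

countTrue : ∀ {k} → (Fin k → Bool) → ℕ
countTrue {zero} f = 0
countTrue {suc k} f = (if f F.zero then 1 else 0) + countTrue (λ i → f (F.suc i))

data Side : Set where
  sideA sideB : Side

module _ (G : BGraph) (b : BGraph.V G → ℕ) where
  open BGraph G

  incident : V → Edge → Bool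
  incident (inj₁ a) e = ⌊ a ≟ endA e ⌋
  incident (inj₂ c) e = ⌊ c ≟ endB e ⌋

  EdgeSet : Set
  EdgeSet = Edge → Bool

  degIn : EdgeSet → V → ℕ
  degIn M v = countTrue (λ e → if M e then incident v e else false)

  size : EdgeSet → ℕ
  size M = countTrue M

  IsBMatching : EdgeSet → Set
  IsBMatching M = ∀ v → degIn M v ≤ b v

  IsMaxBMatching : EdgeSet → Set
  IsMaxBMatching M = IsBMatching M × (∀ N → IsBMatching N → size N ≤ size M)

  Loose : EdgeSet → V → Set
  Loose M v = degIn M v < b v

  Allowed : Edge → Set
  Allowed e = Σ EdgeSet λ M → IsMaxBMatching M × M e ≡ true

  Forbidden : Edge → Set
  Forbidden e = ¬ Allowed e

  Inevitable : Edge → Set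
  Inevitable e = Allowed e × (∀ M → IsMaxBMatching M → M e ≡ true)

  Flexible : Edge → Set
  Flexible e = Allowed e × ¬ (∀ M → IsMaxBMatching M → M e ≡ true)

  FlexStep : V → V → Set
  FlexStep u v = Σ Edge λ e → Flexible e ×
    ((u ≡ inj₁ (endA e) × v ≡ inj₂ (endB e)) ⊎ (u ≡ inj₂ (endB e) × v ≡ inj₁ (endA e)))

  -- u and v lie in the same flexible component; flexible components are
  -- represented by any of their vertices, up to this equivalence.
  SameComp : V → V → Set
  SameComp = Star FlexStep

  InD : V → Set
  InD v = Σ EdgeSet λ M → IsMaxBMatching M × Loose M v

  LooseComp : V → Set
  LooseComp x = Σ V λ w → SameComp x w × InD w

  Adjacent : V → V → Set
  Adjacent u v = Σ Edge λ e →
    ((u ≡ inj₁ (endA e) × v ≡ inj₂ (endB e)) ⊎ (u ≡ inj₂ (endB e) × v ≡ inj₁ (endA e)))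

  -- the component of x is G[{v}] with v inactive
  InactiveCompWith : V → V → Set
  InactiveCompWith x v = b v ≡ 0 × SameComp x v × (∀ w → SameComp x w → w ≡ v)

  Inconsistent : V → Set
  Inconsistent x = LooseComp x
    ⊎ Σ V (λ v → InactiveCompWith x v × Σ V λ u → Adjacent v u × InD u)

  Consistent : V → Set
  Consistent x = ¬ Inconsistent x

  endW : Side → Edge → V
  endW sideA e = inj₁ (endA e)
  endW sideB e = inj₂ (endB e)

  endW̄ : Side → Edge → V
  endW̄ sideA e = inj₂ (endB e)
  endW̄ sideB e = inj₁ (endA e)

  Pre : Side → V → V → Set
  Pre W x y = SameComp x y
    ⊎ Σ Edge (λ e → Inevitable e × SameComp x (endW W e) × SameComp y (endW̄ W e))
    ⊎ Σ Edge (λ e → Forbidden e × SameComp y (endW W e) × SameComp x (endW̄ W e))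

  data Chain (W : Side) : V → V → Set where
    single : ∀ {x} → Consistent x → Chain W x x
    cons   : ∀ {x y z} → Consistent x → Pre W x y → Chain W y z → Chain W x z

  𝒞 : Set
  𝒞 = Σ V Consistent

  _≈𝒞_ : 𝒞 → 𝒞 → Set
  C₁ ≈𝒞 C₂ = SameComp (proj₁ C₁) (proj₁ C₂)

  Le : Side → 𝒞 → 𝒞 → Set
  Le W C₁ C₂ = Chain W (proj₁ C₁) (proj₁ C₂)

-- Fix a maximum b-matching M and orient every edge from A to B if it is in M and from B to A
-- otherwise.  If another maximum b-matching M′ differs from M on an edge g whose head lies in a
-- component without vertices of 𝒟, then every vertex reachable from that head along M ⊕ M′ is in
-- the same component, hence tight in both matchings, hence has equal in- and out-degree in
-- M ⊕ M′; such a reachable set admits no entering arc, so it contains the tail of g and g lies on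
-- a directed cycle.  Consequently every flexible edge of a consistent component can be traversed
-- in both directions, an inevitable or forbidden edge (these keep their orientation in every
-- maximum b-matching) leads from C₁ to C₂ whenever it witnesses C₁ ⪯°_A C₂, and C₁ ≤_A C₂ yields
-- a directed walk from C₁ to C₂.  If C₁ ≤_A C₂ ≤_A C₁ used an inevitable or forbidden edge e,
-- then e would lie on a directed cycle; flipping M along a simple cycle through e gives a maximum
-- b-matching that disagrees with M on e, which is impossible.  Consistency is only used through
-- non-looseness.  Maximum b-matchings and reachable sets are obtained inside the double-negation
-- monad, which suffices because the contradiction is a negative statement.
module Submission where

open import Defs

import Algebra.Properties.CommutativeMonoid.Sum as Sum
open import Data.Bool using (Bool; true; false; if_then_else_; not; _∧_; _∨_; _xor_)
open import Data.Bool.Properties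
  using (∧-identityʳ; ∧-zeroʳ; not-injective; not-¬; xor-comm; true-xor; xor-assoc; xor-same; T-≡)
open import Data.Empty using (⊥; ⊥-elim)
open import Data.Fin using (Fin; _≟_)
import Data.Fin as F
open import Data.Nat using (ℕ; zero; suc; _+_; _≤_; z≤n; s≤s)
open import Data.Nat.Properties
  using (+-0-commutativeMonoid; +-identityʳ; +-assoc; +-comm; +-suc; +-cancelˡ-≡; +-cancelʳ-≡;
         +-monoˡ-≤; m+n≡0⇒m≡0; m+n≡0⇒n≡0; m≤n⇒m≤1+n; m≤n+m; ≤-trans; ≤-antisym; ≮⇒≥)
open import Data.Product using (Σ; _×_; _,_; proj₁; proj₂)
open import Data.Sum using (_⊎_; inj₁; inj₂)
open import Data.Sum.Properties using (≡-dec)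
open import Effect.Monad using (RawMonad)
open import Function using (_∘_; _⇔_; mk⇔; Equivalence)
open import Level using (0ℓ)
open import Relation.Binary.Construct.Closure.ReflexiveTransitive using (Star; ε; _◅_; _◅◅_)
import Relation.Binary.Construct.Closure.ReflexiveTransitive as Star
open import Relation.Binary.PropositionalEquality
  using (_≡_; _≢_; refl; sym; trans; cong; cong₂; subst; subst₂; module ≡-Reasoning)
open import Relation.Binary.Structures using (IsPartialOrder)
open import Relation.Nullary using (¬_; Dec; yes; no)
open import Relation.Nullary.Decidable using (⌊_⌋; ⌊⌋-map′; toWitness; fromWitness)
open import Relation.Nullary.Decidable.Core using (¬¬-excluded-middle; _⊎-dec_)
open import Relation.Nullary.Negation using (¬¬-map; ¬¬-Monad)

open Sum +-0-commutativeMonoid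
  using (sum-syntax; ∑-distrib-+; ∑-comm; sum-cong-≗; sum-replicate-zero)
open RawMonad (¬¬-Monad {a = 0ℓ}) using (pure; _>>=_)

-- Counting

toℕ : Bool → ℕ
toℕ b = if b then 1 else 0

⌊⌋≡true⇒ : ∀ {A : Set} (d : Dec A) → ⌊ d ⌋ ≡ true → A
⌊⌋≡true⇒ d ⌊d⌋≡true = toWitness {a? = d} (Equivalence.from T-≡ ⌊d⌋≡true)

⌊⌋-true : ∀ {A : Set} (d : Dec A) → A → ⌊ d ⌋ ≡ true
⌊⌋-true d a = Equivalence.to T-≡ (fromWitness {a? = d} a)

countTrue≡∑ : ∀ {k} (f : Fin k → Bool) → countTrue f ≡ ∑[ i < k ] toℕ (f i)
countTrue≡∑ {zero}  f = refl
countTrue≡∑ {suc k} f = cong (toℕ (f F.zero) +_) (countTrue≡∑ (f ∘ F.suc))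

countTrue-cong : ∀ {k} {f g : Fin k → Bool} → (∀ i → f i ≡ g i) → countTrue f ≡ countTrue g
countTrue-cong {k} {f} {g} f≗g = begin
  countTrue f           ≡⟨ countTrue≡∑ f ⟩
  ∑[ i < k ] toℕ (f i)  ≡⟨ sum-cong-≗ (λ i → cong toℕ (f≗g i)) ⟩
  ∑[ i < k ] toℕ (g i)  ≡⟨ countTrue≡∑ g ⟨
  countTrue g           ∎
  where open ≡-Reasoning

countTrue-+ : ∀ {k} (f g : Fin k → Bool) →
  countTrue f + countTrue g ≡ ∑[ i < k ] (toℕ (f i) + toℕ (g i))
countTrue-+ f g =
  trans (cong₂ _+_ (countTrue≡∑ f) (countTrue≡∑ g)) (sym (∑-distrib-+ (toℕ ∘ f) (toℕ ∘ g)))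

countTrue-const-false : ∀ k → countTrue {k} (λ _ → false) ≡ 0
countTrue-const-false zero    = refl
countTrue-const-false (suc k) = countTrue-const-false k

countTrue≤ : ∀ {k} (f : Fin k → Bool) → countTrue f ≤ k
countTrue≤ {zero}  f = z≤n
countTrue≤ {suc k} f with f F.zero
... | true  = s≤s (countTrue≤ (f ∘ F.suc))
... | false = m≤n⇒m≤1+n (countTrue≤ (f ∘ F.suc))

countTrue≡0⇒false : ∀ {k} (f : Fin k → Bool) → countTrue f ≡ 0 → ∀ i → f i ≡ false
countTrue≡0⇒false {suc k} f count≡0 F.zero = toℕ≡0 (f F.zero) (m+n≡0⇒m≡0 _ count≡0)
  where
  toℕ≡0 : ∀ b → toℕ b ≡ 0 → b ≡ false
  toℕ≡0 false _ = refl
countTrue≡0⇒false {suc k} f count≡0 (F.suc i) =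
  countTrue≡0⇒false (f ∘ F.suc) (m+n≡0⇒n≡0 _ count≡0) i

∑-indicator : ∀ {n} (j : Fin n) (q : Fin n → Bool) → ∑[ i < n ] toℕ (⌊ i ≟ j ⌋ ∧ q i) ≡ toℕ (q j)
∑-indicator {suc n} F.zero q = begin
  toℕ (q F.zero) + ∑[ i < n ] 0  ≡⟨ cong (toℕ (q F.zero) +_) (sum-replicate-zero n) ⟩
  toℕ (q F.zero) + 0             ≡⟨ +-identityʳ _ ⟩
  toℕ (q F.zero)                 ∎
  where open ≡-Reasoning
∑-indicator {suc n} (F.suc j) q = begin
  ∑[ i < n ] toℕ (⌊ F.suc i ≟ F.suc j ⌋ ∧ q (F.suc i))
    ≡⟨ sum-cong-≗ (λ i → cong (λ d → toℕ (d ∧ q (F.suc i))) (⌊⌋-map′ _ _ (i ≟ j))) ⟩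
  ∑[ i < n ] toℕ (⌊ i ≟ j ⌋ ∧ q (F.suc i))
    ≡⟨ ∑-indicator j (q ∘ F.suc) ⟩
  toℕ (q (F.suc j)) ∎
  where open ≡-Reasoning

countTrue-insert : ∀ {k} (P X : Fin k → Bool) (j : Fin k) → X j ≡ false →
  countTrue (λ i → P i ∧ (⌊ i ≟ j ⌋ ∨ X i)) ≡ toℕ (P j) + countTrue (λ i → P i ∧ X i)
countTrue-insert {k} P X j Xj≡false = begin
  countTrue (λ i → P i ∧ (⌊ i ≟ j ⌋ ∨ X i))
    ≡⟨ countTrue≡∑ (λ i → P i ∧ (⌊ i ≟ j ⌋ ∨ X i)) ⟩
  ∑[ i < k ] toℕ (P i ∧ (⌊ i ≟ j ⌋ ∨ X i))
    ≡⟨ sum-cong-≗ split ⟩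
  ∑[ i < k ] (toℕ (⌊ i ≟ j ⌋ ∧ P i) + toℕ (P i ∧ X i))
    ≡⟨ ∑-distrib-+ (λ i → toℕ (⌊ i ≟ j ⌋ ∧ P i)) (λ i → toℕ (P i ∧ X i)) ⟩
  ∑[ i < k ] toℕ (⌊ i ≟ j ⌋ ∧ P i) + ∑[ i < k ] toℕ (P i ∧ X i)
    ≡⟨ cong₂ _+_ (∑-indicator j P) (sym (countTrue≡∑ (λ i → P i ∧ X i))) ⟩
  toℕ (P j) + countTrue (λ i → P i ∧ X i) ∎
  where
  open ≡-Reasoning
  split : ∀ i → toℕ (P i ∧ (⌊ i ≟ j ⌋ ∨ X i)) ≡ toℕ (⌊ i ≟ j ⌋ ∧ P i) + toℕ (P i ∧ X i)
  split i with i ≟ j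
  ... | no _ = refl
  ... | yes refl rewrite Xj≡false with P i
  ...   | true  = refl
  ...   | false = refl

¬¬-∀Fin : ∀ {n} {P : Fin n → Set} → (∀ i → ¬ ¬ P i) → ¬ ¬ (∀ i → P i)
¬¬-∀Fin {zero}  ¬¬P ¬∀P = ¬∀P (λ ())
¬¬-∀Fin {suc n} ¬¬P ¬∀P =
  ¬¬P F.zero λ P0 → ¬¬-∀Fin (¬¬P ∘ F.suc) λ Psuc → ¬∀P λ { F.zero → P0 ; (F.suc i) → Psuc i }

¬¬-argmax : ∀ {A : Set} (f : A → ℕ) {B} → (∀ a → f a ≤ B) → A →
  ¬ ¬ Σ A λ a → ∀ a′ → f a′ ≤ f a
¬¬-argmax {A} f {B} bounded a₀ = go B a₀ (m≤n+m B (f a₀))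
  where
  go : ∀ slack a → B ≤ f a + slack → ¬ ¬ Σ A λ a → ∀ a′ → f a′ ≤ f a
  go zero        a B≤fa no-max =
    no-max (a , λ a′ → ≤-trans (bounded a′) (subst (B ≤_) (+-identityʳ (f a)) B≤fa))
  go (suc slack) a B≤fa+1+slack no-max = no-max (a , λ a′ → ≮⇒≥ λ fa<fa′ →
    go slack a′ (≤-trans B≤fa+1+slack (subst (_≤ f a′ + slack) (sym (+-suc (f a) slack))
                                              (+-monoˡ-≤ slack fa<fa′)))
       no-max)

-- Directed graphs on the vertex set

module _ (G : BGraph) where
  open BGraph G

  _≟V_ : (u v : V) → Dec (u ≡ v)
  _≟V_ = ≡-dec _≟_ _≟_

  -- Unlike ⌊ u ≟V v ⌋, this reduces on the constructors, so that incident G b v e is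
  -- definitionally v ≐ (the end of e on the side of v).
  _≐_ : V → V → Bool
  inj₁ a ≐ inj₁ a′ = ⌊ a ≟ a′ ⌋
  inj₂ c ≐ inj₂ c′ = ⌊ c ≟ c′ ⌋
  _      ≐ _       = false

  ≐⇒≡ : ∀ {u v} → u ≐ v ≡ true → u ≡ v
  ≐⇒≡ {inj₁ a} {inj₁ a′} eq = cong inj₁ (⌊⌋≡true⇒ (a ≟ a′) eq)
  ≐⇒≡ {inj₂ c} {inj₂ c′} eq = cong inj₂ (⌊⌋≡true⇒ (c ≟ c′) eq)

  ¬¬-∀V : {P : V → Set} → (∀ v → ¬ ¬ P v) → ¬ ¬ (∀ v → P v)
  ¬¬-∀V ¬¬P ¬∀P =
    ¬¬-∀Fin (¬¬P ∘ inj₁) λ PA → ¬¬-∀Fin (¬¬P ∘ inj₂) λ PB →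
    ¬∀P λ { (inj₁ a) → PA a ; (inj₂ c) → PB c }

  ∑ᵥ : (V → ℕ) → ℕ
  ∑ᵥ f = ∑[ a < nA ] f (inj₁ a) + ∑[ c < nB ] f (inj₂ c)

  ∑ᵥ-cong : ∀ {f g : V → ℕ} → (∀ v → f v ≡ g v) → ∑ᵥ f ≡ ∑ᵥ g
  ∑ᵥ-cong f≗g = cong₂ _+_ (sum-cong-≗ (f≗g ∘ inj₁)) (sum-cong-≗ (f≗g ∘ inj₂))

  ∑ᵥ-indicator : ∀ y q → ∑ᵥ (λ v → toℕ ((v ≐ y) ∧ q)) ≡ toℕ q
  ∑ᵥ-indicator (inj₁ a) q = begin
    ∑[ a′ < nA ] toℕ (⌊ a′ ≟ a ⌋ ∧ q) + ∑[ c < nB ] 0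
      ≡⟨ cong₂ _+_ (∑-indicator a (λ _ → q)) (sum-replicate-zero nB) ⟩
    toℕ q + 0
      ≡⟨ +-identityʳ _ ⟩
    toℕ q ∎
    where open ≡-Reasoning
  ∑ᵥ-indicator (inj₂ c) q = cong₂ _+_ (sum-replicate-zero nA) (∑-indicator c (λ _ → q))

  ∑ᵥ-countTrue : (end : Edge → V) (P : Edge → Bool) →
    ∑ᵥ (λ v → countTrue (λ e → (v ≐ end e) ∧ P e)) ≡ countTrue P
  ∑ᵥ-countTrue end P = begin
    ∑ᵥ (λ v → countTrue (λ e → (v ≐ end e) ∧ P e))
      ≡⟨ ∑ᵥ-cong (λ v → countTrue≡∑ (λ e → (v ≐ end e) ∧ P e)) ⟩
    ∑[ a < nA ] ∑[ e < m ] f (inj₁ a) e + ∑[ c < nB ] ∑[ e < m ] f (inj₂ c) e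
      ≡⟨ cong₂ _+_ (∑-comm (f ∘ inj₁)) (∑-comm (f ∘ inj₂)) ⟩
    ∑[ e < m ] ∑[ a < nA ] f (inj₁ a) e + ∑[ e < m ] ∑[ c < nB ] f (inj₂ c) e
      ≡⟨ ∑-distrib-+ (λ e → ∑[ a < nA ] f (inj₁ a) e) (λ e → ∑[ c < nB ] f (inj₂ c) e) ⟨
    ∑[ e < m ] ∑ᵥ (λ v → f v e)
      ≡⟨ sum-cong-≗ (λ e → ∑ᵥ-indicator (end e) (P e)) ⟩
    ∑[ e < m ] toℕ (P e)
      ≡⟨ countTrue≡∑ P ⟨
    countTrue P ∎
    where
    open ≡-Reasoning
    f : V → Edge → ℕ
    f v e = toℕ ((v ≐ end e) ∧ P e)

  countTrue-∘end : (end : Edge → V) (X : Edge → Bool) (S : V → Bool) →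
    countTrue (λ e → X e ∧ S (end e))
      ≡ ∑ᵥ (λ v → if S v then countTrue (λ e → (v ≐ end e) ∧ X e) else 0)
  countTrue-∘end end X S = trans (sym (∑ᵥ-countTrue end (λ e → X e ∧ S (end e)))) (∑ᵥ-cong at)
    where
    S-at-end : ∀ v e → (v ≐ end e) ∧ (X e ∧ S (end e)) ≡ (v ≐ end e) ∧ (X e ∧ S v)
    S-at-end v e with v ≐ end e in v≐end
    ... | true  = cong (λ u → X e ∧ S u) (sym (≐⇒≡ v≐end))
    ... | false = refl
    restrict : ∀ v s → countTrue (λ e → (v ≐ end e) ∧ (X e ∧ s))
                     ≡ (if s then countTrue (λ e → (v ≐ end e) ∧ X e) else 0)
    restrict v true  = countTrue-cong (λ e → cong ((v ≐ end e) ∧_) (∧-identityʳ (X e)))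
    restrict v false =
      trans (countTrue-cong (λ e → trans (cong ((v ≐ end e) ∧_) (∧-zeroʳ (X e))) (∧-zeroʳ _)))
            (countTrue-const-false m)
    at : ∀ v → countTrue (λ e → (v ≐ end e) ∧ (X e ∧ S (end e)))
             ≡ (if S v then countTrue (λ e → (v ≐ end e) ∧ X e) else 0)
    at v = trans (countTrue-cong (S-at-end v)) (restrict v (S v))

  module Digraph (tail head : Edge → V) where

    outdeg indeg : (Edge → Bool) → V → ℕ
    outdeg X v = countTrue (λ e → (v ≐ tail e) ∧ X e)
    indeg  X v = countTrue (λ e → (v ≐ head e) ∧ X e)

    Balanced : (Edge → Bool) → V → Set
    Balanced X v = outdeg X v ≡ indeg X v

    tail∈≡head∈ : ∀ (X : Edge → Bool) (S : V → Bool) → (∀ v → S v ≡ true → Balanced X v) →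
      countTrue (λ e → X e ∧ S (tail e)) ≡ countTrue (λ e → X e ∧ S (head e))
    tail∈≡head∈ X S balanced = begin
      countTrue (λ e → X e ∧ S (tail e))        ≡⟨ countTrue-∘end tail X S ⟩
      ∑ᵥ (λ v → if S v then outdeg X v else 0)  ≡⟨ ∑ᵥ-cong at ⟩
      ∑ᵥ (λ v → if S v then indeg X v else 0)   ≡⟨ countTrue-∘end head X S ⟨
      countTrue (λ e → X e ∧ S (head e))        ∎
      where
      open ≡-Reasoning
      at : ∀ v → (if S v then outdeg X v else 0) ≡ (if S v then indeg X v else 0)
      at v with S v in Sv
      ... | true  = balanced v Sv
      ... | false = refl

    -- The arcs of X ending in S are those starting in S (closure) plus those entering S, and
    -- by balance there are as many of the former as arcs ending in S.
    balanced-closed⇒no-arc-enters : ∀ (X : Edge → Bool) (S : V → Bool) →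
      (∀ v → S v ≡ true → Balanced X v) →
      (∀ e → X e ≡ true → S (tail e) ≡ true → S (head e) ≡ true) →
      ∀ g → X g ≡ true → S (head g) ≡ true → S (tail g) ≡ true
    balanced-closed⇒no-arc-enters X S balanced closed g Xg Sh =
      not-injective (trans (sym Entering-g) (countTrue≡0⇒false Entering no-entering g))
      where
      Entering : Edge → Bool
      Entering e = (X e ∧ S (head e)) ∧ not (S (tail e))
      split : ∀ x st sh → (x ≡ true → st ≡ true → sh ≡ true) →
        toℕ (x ∧ sh) ≡ toℕ (x ∧ st) + toℕ ((x ∧ sh) ∧ not st)
      split false st    sh    _ = refl
      split true  true  sh    c rewrite c refl refl = refl
      split true  false true  _ = refl
      split true  false false _ = refl
      starting+entering : countTrue (λ e → X e ∧ S (tail e)) + countTrue Entering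
                        ≡ countTrue (λ e → X e ∧ S (tail e)) + 0
      starting+entering = begin
        countTrue (λ e → X e ∧ S (tail e)) + countTrue Entering
          ≡⟨ countTrue-+ (λ e → X e ∧ S (tail e)) Entering ⟩
        ∑[ e < m ] (toℕ (X e ∧ S (tail e)) + toℕ (Entering e))
          ≡⟨ sum-cong-≗ (λ e → split (X e) (S (tail e)) (S (head e)) (closed e)) ⟨
        ∑[ e < m ] toℕ (X e ∧ S (head e))
          ≡⟨ countTrue≡∑ (λ e → X e ∧ S (head e)) ⟨
        countTrue (λ e → X e ∧ S (head e))
          ≡⟨ tail∈≡head∈ X S balanced ⟨
        countTrue (λ e → X e ∧ S (tail e))
          ≡⟨ +-identityʳ _ ⟨
        countTrue (λ e → X e ∧ S (tail e)) + 0 ∎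
        where open ≡-Reasoning
      Entering-g : Entering g ≡ not (S (tail g))
      Entering-g = cong₂ (λ x s → (x ∧ s) ∧ not (S (tail g))) Xg Sh
      no-entering : countTrue Entering ≡ 0
      no-entering = +-cancelˡ-≡ _ _ _ starting+entering

    ArcIn : (Edge → Bool) → V → V → Set
    ArcIn X u v = Σ Edge λ e → X e ≡ true × tail e ≡ u × head e ≡ v

    Arc : V → V → Set
    Arc u v = Σ Edge λ e → tail e ≡ u × head e ≡ v

    Walk : V → V → Set
    Walk = Star Arc

    balanced-reach⇒on-cycle : ∀ (X : Edge → Bool) g → X g ≡ true →
      (∀ v → Star (ArcIn X) (head g) v → Balanced X v) → ¬ ¬ Walk (head g) (tail g)
    balanced-reach⇒on-cycle X g Xg balanced =
      ¬¬-map reach-tail (¬¬-∀V (λ _ → ¬¬-excluded-middle))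
      where
      Reach : V → Set
      Reach = Star (ArcIn X) (head g)
      reach-tail : (∀ v → Dec (Reach v)) → Walk (head g) (tail g)
      reach-tail reach? =
        Star.map (λ (e , _ , t , h) → e , t , h) (⌊⌋≡true⇒ (reach? (tail g)) tail-reached)
        where
        S : V → Bool
        S v = ⌊ reach? v ⌋
        tail-reached : S (tail g) ≡ true
        tail-reached = balanced-closed⇒no-arc-enters X S
          (λ v Sv → balanced v (⌊⌋≡true⇒ (reach? v) Sv))
          (λ e Xe Stail → ⌊⌋-true (reach? (head e))
                            (⌊⌋≡true⇒ (reach? (tail e)) Stail ◅◅ ((e , Xe , refl , refl) ◅ ε)))
          g Xg (⌊⌋-true (reach? (head g)) ε)

    _∈ᵥ_ : ∀ {u v} → V → Walk u v → Set
    _∈ᵥ_ {v = v} w ε       = w ≡ v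
    _∈ᵥ_ {u = u} w (_ ◅ p) = w ≡ u ⊎ w ∈ᵥ p

    _∈ᵥ?_ : ∀ {u v} w (p : Walk u v) → Dec (w ∈ᵥ p)
    w ∈ᵥ? ε       = w ≟V _
    w ∈ᵥ? (_ ◅ p) = (w ≟V _) ⊎-dec (w ∈ᵥ? p)

    end∈ᵥ : ∀ {u v} (p : Walk u v) → v ∈ᵥ p
    end∈ᵥ ε       = refl
    end∈ᵥ (_ ◅ p) = inj₂ (end∈ᵥ p)

    data IsPath : ∀ {u v} → Walk u v → Set where
      []  : ∀ {v} → IsPath (ε {x = v})
      _∷_ : ∀ {u w v} {a : Arc u w} {p : Walk w v} → ¬ u ∈ᵥ p → IsPath p → IsPath (a ◅ p)

    Path : V → V → Set
    Path u v = Σ (Walk u v) IsPath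

    suffix : ∀ {u v w} (p : Walk u v) → IsPath p → w ∈ᵥ p → Path w v
    suffix ε       []             refl        = ε , []
    suffix (a ◅ p) (u∉p ∷ p-path) (inj₁ refl) = a ◅ p , u∉p ∷ p-path
    suffix (a ◅ p) (_   ∷ p-path) (inj₂ w∈p)  = suffix p p-path w∈p

    walk⇒path : ∀ {u v} → Walk u v → Path u v
    walk⇒path ε = ε , []
    walk⇒path {u} (a ◅ p) with walk⇒path p
    ... | q , q-path with u ∈ᵥ? q
    ...   | yes u∈q = suffix q q-path u∈q
    ...   | no  u∉q = a ◅ q , u∉q ∷ q-path

    edgesOf : ∀ {u v} → Walk u v → Edge → Bool
    edgesOf ε              e = false
    edgesOf ((e′ , _) ◅ p) e = ⌊ e ≟ e′ ⌋ ∨ edgesOf p e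

    edge-tail∈ᵥ : ∀ {u v} (p : Walk u v) e → edgesOf p e ≡ true → tail e ∈ᵥ p
    edge-tail∈ᵥ ((e′ , t , _) ◅ p) e e∈p with e ≟ e′
    ... | yes refl = inj₁ t
    ... | no  _    = inj₂ (edge-tail∈ᵥ p e e∈p)

    edge-tail≢end : ∀ {u v} {p : Walk u v} → IsPath p → ∀ e → edgesOf p e ≡ true → tail e ≢ v
    edge-tail≢end {p = (e′ , t , _) ◅ p} (u∉p ∷ p-path) e e∈p with e ≟ e′
    ... | yes refl = λ t≡v → u∉p (subst (_∈ᵥ p) (trans (sym t≡v) t) (end∈ᵥ p))
    ... | no  _    = edge-tail≢end p-path e e∈p

    path-balance : ∀ {u v} {p : Walk u v} → IsPath p → ∀ w →
      outdeg (edgesOf p) w + toℕ (w ≐ v) ≡ indeg (edgesOf p) w + toℕ (w ≐ u)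
    path-balance [] w = cong (_+ _) (trans (no-edges tail) (sym (no-edges head)))
      where
      no-edges : ∀ (end : Edge → V) → countTrue (λ e → (w ≐ end e) ∧ false) ≡ 0
      no-edges end = trans (countTrue-cong (λ e → ∧-zeroʳ (w ≐ end e))) (countTrue-const-false m)
    path-balance {v = v} {p = (e₀ , refl , refl) ◅ p} (u∉p ∷ p-path) w = begin
      outdeg X′ w + toℕ (w ≐ v)
        ≡⟨ cong (_+ toℕ (w ≐ v)) (countTrue-insert (λ e → w ≐ tail e) X e₀ e₀∉p) ⟩
      (toℕ (w ≐ tail e₀) + outdeg X w) + toℕ (w ≐ v)
        ≡⟨ +-assoc (toℕ (w ≐ tail e₀)) _ _ ⟩
      toℕ (w ≐ tail e₀) + (outdeg X w + toℕ (w ≐ v))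
        ≡⟨ cong (toℕ (w ≐ tail e₀) +_) (path-balance p-path w) ⟩
      toℕ (w ≐ tail e₀) + (indeg X w + toℕ (w ≐ head e₀))
        ≡⟨ +-comm (toℕ (w ≐ tail e₀)) _ ⟩
      (indeg X w + toℕ (w ≐ head e₀)) + toℕ (w ≐ tail e₀)
        ≡⟨ cong (_+ toℕ (w ≐ tail e₀)) (+-comm (indeg X w) _) ⟩
      (toℕ (w ≐ head e₀) + indeg X w) + toℕ (w ≐ tail e₀)
        ≡⟨ cong (_+ toℕ (w ≐ tail e₀)) (countTrue-insert (λ e → w ≐ head e) X e₀ e₀∉p) ⟨
      indeg X′ w + toℕ (w ≐ tail e₀) ∎
      where
      open ≡-Reasoning
      X X′ : Edge → Bool
      X  = edgesOf p
      X′ = edgesOf ((e₀ , refl , refl) ◅ p)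
      e₀∉p : X e₀ ≡ false
      e₀∉p with X e₀ in e₀∈p
      ... | true  = ⊥-elim (u∉p (edge-tail∈ᵥ p e₀ e₀∈p))
      ... | false = refl

    closing-arc⇒balanced-cycle : ∀ f → Walk (head f) (tail f) →
      Σ (Edge → Bool) λ X → X f ≡ true × ∀ w → Balanced X w
    closing-arc⇒balanced-cycle f walk with walk⇒path walk
    ... | p , p-path = X , cong (_∨ edgesOf p f) (⌊⌋-true (f ≟ f) refl) , balanced
      where
      X : Edge → Bool
      X e = ⌊ e ≟ f ⌋ ∨ edgesOf p e
      f∉p : edgesOf p f ≡ false
      f∉p with edgesOf p f in f∈p
      ... | true  = ⊥-elim (edge-tail≢end p-path f f∈p refl)
      ... | false = refl
      balanced : ∀ w → Balanced X w
      balanced w = begin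
        outdeg X w
          ≡⟨ countTrue-insert (λ e → w ≐ tail e) (edgesOf p) f f∉p ⟩
        toℕ (w ≐ tail f) + outdeg (edgesOf p) w
          ≡⟨ +-comm (toℕ (w ≐ tail f)) _ ⟩
        outdeg (edgesOf p) w + toℕ (w ≐ tail f)
          ≡⟨ path-balance p-path w ⟩
        indeg (edgesOf p) w + toℕ (w ≐ head f)
          ≡⟨ +-comm (indeg (edgesOf p) w) _ ⟩
        toℕ (w ≐ head f) + indeg (edgesOf p) w
          ≡⟨ countTrue-insert (λ e → w ≐ head e) (edgesOf p) f f∉p ⟨
        indeg X w ∎
        where open ≡-Reasoning

  -- Orientation by a b-matching and alternating cycles

  source target : Bool → Edge → V
  source true  e = inj₁ (endA e)
  source false e = inj₂ (endB e)
  target true  e = inj₂ (endB e)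
  target false e = inj₁ (endA e)

  Joins : Edge → V → V → Set
  Joins e u v = (u ≡ inj₁ (endA e) × v ≡ inj₂ (endB e)) ⊎ (u ≡ inj₂ (endB e) × v ≡ inj₁ (endA e))

  module _ (b : V → ℕ) where

    IsMax : EdgeSet G b → Set
    IsMax = IsMaxBMatching G b

    tailᴹ headᴹ : EdgeSet G b → Edge → V
    tailᴹ M e = source (M e) e
    headᴹ M e = target (M e) e

    module Oriented (M : EdgeSet G b) = Digraph (tailᴹ M) (headᴹ M)

    Walk : EdgeSet G b → V → V → Set
    Walk M = Oriented.Walk M

    oriented-by : ∀ {M e} β → M e ≡ β → Oriented.Arc M (source β e) (target β e)
    oriented-by {e = e} β Me≡β = e , cong (λ m → source m e) Me≡β , cong (λ m → target m e) Me≡β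

    arc⇒joins : ∀ M {e u v} → tailᴹ M e ≡ u → headᴹ M e ≡ v → Joins e u v
    arc⇒joins M {e} t h with M e
    ... | true  = inj₁ (sym t , sym h)
    ... | false = inj₂ (sym t , sym h)

    joins⇒oriented : ∀ M {e u v} → Joins e u v →
      (tailᴹ M e ≡ u × headᴹ M e ≡ v) ⊎ (tailᴹ M e ≡ v × headᴹ M e ≡ u)
    joins⇒oriented M {e} joins with M e | joins
    ... | true  | inj₁ (refl , refl) = inj₁ (refl , refl)
    ... | true  | inj₂ (refl , refl) = inj₂ (refl , refl)
    ... | false | inj₁ (refl , refl) = inj₂ (refl , refl)
    ... | false | inj₂ (refl , refl) = inj₁ (refl , refl)

    _⊕_ : EdgeSet G b → EdgeSet G b → EdgeSet G b
    (M ⊕ X) e = M e xor X e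

    matchedDeg unmatchedDeg : EdgeSet G b → EdgeSet G b → V → ℕ
    matchedDeg   M X v = countTrue (λ e → (M e ∧ incident G b v e) ∧ X e)
    unmatchedDeg M X v = countTrue (λ e → (not (M e) ∧ incident G b v e) ∧ X e)

    degIn-⊕ : ∀ M X v →
      degIn G b (M ⊕ X) v + matchedDeg M X v ≡ degIn G b M v + unmatchedDeg M X v
    degIn-⊕ M X v = begin
      degIn G b (M ⊕ X) v + matchedDeg M X v
        ≡⟨ countTrue-+ (λ e → if (M ⊕ X) e then i e else false) (λ e → (M e ∧ i e) ∧ X e) ⟩
      ∑[ e < m ] (toℕ (if (M ⊕ X) e then i e else false) + toℕ ((M e ∧ i e) ∧ X e))
        ≡⟨ sum-cong-≗ (λ e → flip-count (M e) (X e) (i e)) ⟩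
      ∑[ e < m ] (toℕ (if M e then i e else false) + toℕ ((not (M e) ∧ i e) ∧ X e))
        ≡⟨ countTrue-+ (λ e → if M e then i e else false) (λ e → (not (M e) ∧ i e) ∧ X e) ⟨
      degIn G b M v + unmatchedDeg M X v ∎
      where
      open ≡-Reasoning
      i : Edge → Bool
      i = incident G b v
      flip-count : ∀ m x i → toℕ (if m xor x then i else false) + toℕ ((m ∧ i) ∧ x)
                           ≡ toℕ (if m then i else false) + toℕ ((not m ∧ i) ∧ x)
      flip-count true  true  true  = refl
      flip-count true  true  false = refl
      flip-count true  false true  = refl
      flip-count true  false false = refl
      flip-count false true  true  = refl
      flip-count false true  false = refl
      flip-count false false true  = refl
      flip-count false false false = refl

    Balanced⇔matched≡unmatched : ∀ M X v →
      Oriented.Balanced M X v ⇔ matchedDeg M X v ≡ unmatchedDeg M X v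
    Balanced⇔matched≡unmatched M X (inj₁ a) = mk⇔
      (λ bal → trans (sym out≡matched) (trans bal in≡unmatched))
      (λ eq → trans out≡matched (trans eq (sym in≡unmatched)))
      where
      at-source : ∀ m e → (inj₁ a ≐ source m e) ≡ m ∧ ⌊ a ≟ endA e ⌋
      at-source true  e = refl
      at-source false e = refl
      at-target : ∀ m e → (inj₁ a ≐ target m e) ≡ not m ∧ ⌊ a ≟ endA e ⌋
      at-target true  e = refl
      at-target false e = refl
      out≡matched : Oriented.outdeg M X (inj₁ a) ≡ matchedDeg M X (inj₁ a)
      out≡matched = countTrue-cong λ e → cong (_∧ X e) (at-source (M e) e)
      in≡unmatched : Oriented.indeg M X (inj₁ a) ≡ unmatchedDeg M X (inj₁ a)
      in≡unmatched = countTrue-cong λ e → cong (_∧ X e) (at-target (M e) e)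
    Balanced⇔matched≡unmatched M X (inj₂ c) = mk⇔
      (λ bal → trans (sym in≡matched) (trans (sym bal) out≡unmatched))
      (λ eq → trans out≡unmatched (trans (sym eq) (sym in≡matched)))
      where
      at-source : ∀ m e → (inj₂ c ≐ source m e) ≡ not m ∧ ⌊ c ≟ endB e ⌋
      at-source true  e = refl
      at-source false e = refl
      at-target : ∀ m e → (inj₂ c ≐ target m e) ≡ m ∧ ⌊ c ≟ endB e ⌋
      at-target true  e = refl
      at-target false e = refl
      out≡unmatched : Oriented.outdeg M X (inj₂ c) ≡ unmatchedDeg M X (inj₂ c)
      out≡unmatched = countTrue-cong λ e → cong (_∧ X e) (at-source (M e) e)
      in≡matched : Oriented.indeg M X (inj₂ c) ≡ matchedDeg M X (inj₂ c)
      in≡matched = countTrue-cong λ e → cong (_∧ X e) (at-target (M e) e)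

    ⊕-preserves-degIn⇔Balanced : ∀ M X v →
      degIn G b (M ⊕ X) v ≡ degIn G b M v ⇔ Oriented.Balanced M X v
    ⊕-preserves-degIn⇔Balanced M X v = mk⇔
      (λ same → Equivalence.from matched⇔ (+-cancelˡ-≡ (degIn G b M v) _ _
        (trans (cong (_+ matchedDeg M X v) (sym same)) (degIn-⊕ M X v))))
      (λ bal → +-cancelʳ-≡ (matchedDeg M X v) _ _
        (trans (degIn-⊕ M X v) (cong (degIn G b M v +_) (sym (Equivalence.to matched⇔ bal)))))
      where
      matched⇔ : Oriented.Balanced M X v ⇔ matchedDeg M X v ≡ unmatchedDeg M X v
      matched⇔ = Balanced⇔matched≡unmatched M X v

    size≡∑degIn : ∀ M → size G b M ≡ ∑[ a < nA ] degIn G b M (inj₁ a)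
    size≡∑degIn M = begin
      size G b M
        ≡⟨ countTrue≡∑ M ⟩
      ∑[ e < m ] toℕ (M e)
        ≡⟨ sum-cong-≗ (λ e → ∑-indicator (endA e) (λ _ → M e)) ⟨
      ∑[ e < m ] ∑[ a < nA ] toℕ (⌊ a ≟ endA e ⌋ ∧ M e)
        ≡⟨ sum-cong-≗ (λ e → sum-cong-≗ (λ a → cong toℕ (matched-at (M e) ⌊ a ≟ endA e ⌋))) ⟩
      ∑[ e < m ] ∑[ a < nA ] toℕ (if M e then ⌊ a ≟ endA e ⌋ else false)
        ≡⟨ ∑-comm (λ e a → toℕ (if M e then ⌊ a ≟ endA e ⌋ else false)) ⟩
      ∑[ a < nA ] ∑[ e < m ] toℕ (if M e then ⌊ a ≟ endA e ⌋ else false)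
        ≡⟨ sum-cong-≗ (λ a → countTrue≡∑ (λ e → if M e then ⌊ a ≟ endA e ⌋ else false)) ⟨
      ∑[ a < nA ] degIn G b M (inj₁ a) ∎
      where
      open ≡-Reasoning
      matched-at : ∀ m d → d ∧ m ≡ (if m then d else false)
      matched-at true  d = ∧-identityʳ d
      matched-at false d = ∧-zeroʳ d

    flip-balanced-isMax : ∀ {M X} → IsMax M → (∀ v → Oriented.Balanced M X v) → IsMax (M ⊕ X)
    flip-balanced-isMax {M} {X} (isBMatching , maximum) balanced =
      (λ v → subst (_≤ b v) (sym (same-degIn v)) (isBMatching v)) ,
      (λ N isBMatchingN → subst (size G b N ≤_) (sym same-size) (maximum N isBMatchingN))
      where
      same-degIn : ∀ v → degIn G b (M ⊕ X) v ≡ degIn G b M v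
      same-degIn v = Equivalence.from (⊕-preserves-degIn⇔Balanced M X v) (balanced v)
      same-size : size G b (M ⊕ X) ≡ size G b M
      same-size = trans (size≡∑degIn (M ⊕ X))
                        (trans (sum-cong-≗ (same-degIn ∘ inj₁)) (sym (size≡∑degIn M)))

    cycle⇒flippable : ∀ {M} → IsMax M → ∀ f → Walk M (headᴹ M f) (tailᴹ M f) →
      Σ (EdgeSet G b) λ M′ → IsMax M′ × M′ f ≡ not (M f)
    cycle⇒flippable {M} isMax f walk with Oriented.closing-arc⇒balanced-cycle M f walk
    ... | X , Xf , balanced =
      M ⊕ X , flip-balanced-isMax isMax balanced ,
      trans (cong (M f xor_) Xf) (trans (xor-comm (M f) true) (true-xor (M f)))

    Fixed : Edge → Bool → Set
    Fixed e β = ∀ M → IsMax M → M e ≡ β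

    fixed⇒acyclic : ∀ {M e β} → IsMax M → Fixed e β → ¬ Walk M (target β e) (source β e)
    fixed⇒acyclic {M} {e} isMax fixed walk with fixed M isMax
    ... | refl with cycle⇒flippable isMax e walk
    ...   | M′ , isMax′ , M′e≡notMe = not-¬ (fixed M′ isMax′) M′e≡notMe

    inevitable⇒fixed : ∀ {e} → Inevitable G b e → Fixed e true
    inevitable⇒fixed = proj₂

    forbidden⇒fixed : ∀ {e} → Forbidden G b e → Fixed e false
    forbidden⇒fixed {e} forbidden M isMax with M e in Me
    ... | true  = ⊥-elim (forbidden (M , isMax , Me))
    ... | false = refl

    -- Flexible components and the order ≤_A

    tight : ∀ {M v} → IsMax M → ¬ InD G b v → degIn G b M v ≡ b v
    tight {M} isMax@(isBMatching , _) v∉D =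
      ≤-antisym (isBMatching _) (≮⇒≥ (λ loose → v∉D (M , isMax , loose)))

    ⊕-flexible : ∀ {M M′ e} → IsMax M → IsMax M′ → (M ⊕ M′) e ≡ true → Flexible G b e
    ⊕-flexible {M} {M′} {e} isMax isMax′ differ with M e in Me | M′ e in M′e
    ... | true  | false = (M , isMax , Me) , λ inevitable → not-¬ (inevitable M′ isMax′) M′e
    ... | false | true  = (M′ , isMax′ , M′e) , λ inevitable → not-¬ (inevitable M isMax) Me

    ⊕-reach⇒sameComp : ∀ {M M′ u v} → IsMax M → IsMax M′ →
      Star (Oriented.ArcIn M (M ⊕ M′)) u v → SameComp G b u v
    ⊕-reach⇒sameComp {M} isMax isMax′ =
      Star.map (λ (e , differ , t , h) → e , ⊕-flexible isMax isMax′ differ , arc⇒joins M t h)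

    ⊕-arc-on-cycle : ∀ {M M′ g} → IsMax M → IsMax M′ → (M ⊕ M′) g ≡ true →
      ¬ LooseComp G b (headᴹ M g) → ¬ ¬ Walk M (headᴹ M g) (tailᴹ M g)
    ⊕-arc-on-cycle {M} {M′} {g} isMax isMax′ differ head-not-loose =
      Oriented.balanced-reach⇒on-cycle M (M ⊕ M′) g differ balanced
      where
      xor-cancel : ∀ x y → x xor (x xor y) ≡ y
      xor-cancel x y = trans (sym (xor-assoc x x y)) (cong (_xor y) (xor-same x))
      balanced : ∀ v → Star (Oriented.ArcIn M (M ⊕ M′)) (headᴹ M g) v →
        Oriented.Balanced M (M ⊕ M′) v
      balanced v reach = Equivalence.to (⊕-preserves-degIn⇔Balanced M (M ⊕ M′) v) (begin
        degIn G b (M ⊕ (M ⊕ M′)) v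
          ≡⟨ countTrue-cong (λ e → cong (λ x → if x then incident G b v e else false)
                                        (xor-cancel (M e) (M′ e))) ⟩
        degIn G b M′ v  ≡⟨ tight isMax′ v∉D ⟩
        b v             ≡⟨ tight isMax v∉D ⟨
        degIn G b M v   ∎)
        where
        open ≡-Reasoning
        v∉D : ¬ InD G b v
        v∉D v∈D = head-not-loose (v , ⊕-reach⇒sameComp isMax isMax′ reach , v∈D)

    flexible⇒differing-max : ∀ {M e} → IsMax M → Flexible G b e →
      ¬ ¬ Σ (EdgeSet G b) λ M′ → IsMax M′ × (M ⊕ M′) e ≡ true
    flexible⇒differing-max {M} {e} isMax ((N , isMaxN , Ne) , not-inevitable) no-differing
      with M e
    ... | true  = not-inevitable in-every-max
      where
      in-every-max : ∀ M′ → IsMax M′ → M′ e ≡ true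
      in-every-max M′ isMax′ with M′ e in M′e
      ... | true  = refl
      ... | false = ⊥-elim (no-differing (M′ , isMax′ , cong not M′e))
    ... | false = no-differing (N , isMaxN , Ne)

    ¬LooseComp-resp : ∀ {u v} → ¬ LooseComp G b u → SameComp G b u v → ¬ LooseComp G b v
    ¬LooseComp-resp u-not-loose u~v (w , v~w , w∈D) = u-not-loose (w , u~v ◅◅ v~w , w∈D)

    flexStep-sym : ∀ {u v} → FlexStep G b u v → FlexStep G b v u
    flexStep-sym (e , flexible , inj₁ (u≡ , v≡)) = e , flexible , inj₂ (v≡ , u≡)
    flexStep-sym (e , flexible , inj₂ (u≡ , v≡)) = e , flexible , inj₁ (v≡ , u≡)

    sameComp-sym : ∀ {u v} → SameComp G b u v → SameComp G b v u
    sameComp-sym = Star.reverse flexStep-sym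

    flexStep⇒walk : ∀ {M u v} → IsMax M → ¬ LooseComp G b u → FlexStep G b u v → ¬ ¬ Walk M u v
    flexStep⇒walk {M} isMax u-not-loose (e , flexible , joins) with joins⇒oriented M joins
    ... | inj₁ (t , h) = pure ((e , t , h) ◅ ε)
    ... | inj₂ (t , h) = do
      M′ , isMax′ , differ ← flexible⇒differing-max isMax flexible
      cycle ← ⊕-arc-on-cycle isMax isMax′ differ (subst (¬_ ∘ LooseComp G b) (sym h) u-not-loose)
      pure (subst₂ (Walk M) h t cycle)

    sameComp⇒walk : ∀ {M u v} → IsMax M → ¬ LooseComp G b u → SameComp G b u v → ¬ ¬ Walk M u v
    sameComp⇒walk isMax u-not-loose ε = pure ε
    sameComp⇒walk isMax u-not-loose (step ◅ steps) = do
      first ← flexStep⇒walk isMax u-not-loose step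
      rest  ← sameComp⇒walk isMax (¬LooseComp-resp u-not-loose (step ◅ ε)) steps
      pure (first ◅◅ rest)

    RigidArc : V → V → Set
    RigidArc x y =
      Σ Edge λ e → Σ Bool λ β → Fixed e β × SameComp G b x (source β e) × SameComp G b y (target β e)

    preᴬ⇒sameComp⊎rigidArc : ∀ {x y} → Pre G b sideA x y → SameComp G b x y ⊎ RigidArc x y
    preᴬ⇒sameComp⊎rigidArc (inj₁ x~y) = inj₁ x~y
    preᴬ⇒sameComp⊎rigidArc (inj₂ (inj₁ (e , inevitable , x~A , y~B))) =
      inj₂ (e , true , inevitable⇒fixed inevitable , x~A , y~B)
    preᴬ⇒sameComp⊎rigidArc (inj₂ (inj₂ (e , forbidden , y~A , x~B))) =
      inj₂ (e , false , forbidden⇒fixed forbidden , x~B , y~A)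

    rigidArc⇒walk : ∀ {M x y} → IsMax M → ¬ LooseComp G b x → ¬ LooseComp G b y →
      RigidArc x y → ¬ ¬ Walk M x y
    rigidArc⇒walk {M} isMax x-not-loose y-not-loose (e , β , fixed , x~tail , y~head) = do
      to-tail   ← sameComp⇒walk isMax x-not-loose x~tail
      from-head ← sameComp⇒walk isMax (¬LooseComp-resp y-not-loose y~head) (sameComp-sym y~head)
      pure (to-tail ◅◅ oriented-by β (fixed M isMax) ◅ from-head)

    preᴬ⇒walk : ∀ {M x y} → IsMax M → ¬ LooseComp G b x → ¬ LooseComp G b y →
      Pre G b sideA x y → ¬ ¬ Walk M x y
    preᴬ⇒walk isMax x-not-loose y-not-loose pre with preᴬ⇒sameComp⊎rigidArc pre
    ... | inj₁ x~y      = sameComp⇒walk isMax x-not-loose x~y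
    ... | inj₂ rigidArc = rigidArc⇒walk isMax x-not-loose y-not-loose rigidArc

    Consistent⇒¬LooseComp : ∀ {x} → Consistent G b x → ¬ LooseComp G b x
    Consistent⇒¬LooseComp consistent loose = consistent (inj₁ loose)

    chain-consistentˡ : ∀ {W x y} → Chain G b W x y → Consistent G b x
    chain-consistentˡ (single consistent)   = consistent
    chain-consistentˡ (cons consistent _ _) = consistent

    chain-++ : ∀ {W x y z} → Chain G b W x y → Chain G b W y z → Chain G b W x z
    chain-++ (single _)                  rest = rest
    chain-++ (cons consistent pre chain) rest = cons consistent pre (chain-++ chain rest)

    chain⇒walk : ∀ {M x y} → IsMax M → Chain G b sideA x y → ¬ ¬ Walk M x y
    chain⇒walk isMax (single _) = pure ε
    chain⇒walk isMax (cons consistent pre chain) = do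
      first ← preᴬ⇒walk isMax (Consistent⇒¬LooseComp consistent)
                              (Consistent⇒¬LooseComp (chain-consistentˡ chain)) pre
      rest  ← chain⇒walk isMax chain
      pure (first ◅◅ rest)

    ∅-isBMatching : IsBMatching G b (λ _ → false)
    ∅-isBMatching v = subst (_≤ b v) (sym (countTrue-const-false m)) z≤n

    ¬¬-max-exists : ¬ ¬ Σ (EdgeSet G b) IsMax
    ¬¬-max-exists =
      ¬¬-map (λ ((M , isBMatching) , maximum) →
                M , isBMatching , λ N isBMatchingN → maximum (N , isBMatchingN))
             (¬¬-argmax (size G b ∘ proj₁) (countTrue≤ ∘ proj₁) ((λ _ → false) , ∅-isBMatching))

    rigidArc-acyclic : ∀ {x y} → Consistent G b x → RigidArc x y → ¬ Chain G b sideA y x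
    rigidArc-acyclic {x} {y} x-consistent (e , β , fixed , x~tail , y~head) back =
      rigid-edge-on-cycle λ ()
      where
      x-not-loose : ¬ LooseComp G b x
      x-not-loose = Consistent⇒¬LooseComp x-consistent
      y-not-loose : ¬ LooseComp G b y
      y-not-loose = Consistent⇒¬LooseComp (chain-consistentˡ back)
      rigid-edge-on-cycle : ¬ ¬ ⊥
      rigid-edge-on-cycle = do
        _ , isMax ← ¬¬-max-exists
        from-head ← sameComp⇒walk isMax (¬LooseComp-resp y-not-loose y~head) (sameComp-sym y~head)
        around    ← chain⇒walk isMax back
        to-tail   ← sameComp⇒walk isMax x-not-loose x~tail
        pure (fixed⇒acyclic isMax fixed (from-head ◅◅ around ◅◅ to-tail))

    chain-antisym : ∀ {x y} → Chain G b sideA x y → Chain G b sideA y x → SameComp G b x y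
    chain-antisym (single _) _ = ε
    chain-antisym (cons x-consistent pre chain) back with preᴬ⇒sameComp⊎rigidArc pre
    ... | inj₁ x~x′ =
      x~x′ ◅◅ chain-antisym chain (chain-++ back (cons x-consistent pre (single (chain-consistentˡ chain))))
    ... | inj₂ rigidArc = ⊥-elim (rigidArc-acyclic x-consistent rigidArc (chain-++ chain back))

-- G need not be simple.
mainTheorem1 : (G : BGraph) → Simple G → (b : BGraph.V G → ℕ) →
    IsPartialOrder (_≈𝒞_ G b) (Le G b sideA)
mainTheorem1 G _ b = record
  { isPreorder = record
    { isEquivalence = record { refl = ε ; sym = sameComp-sym G b ; trans = _◅◅_ }
    ; reflexive     = λ {C₁} {C₂} C₁~C₂ → cons (proj₂ C₁) (inj₁ C₁~C₂) (single (proj₂ C₂))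
    ; trans         = chain-++ G b
    }
  ; antisym = chain-antisym G b
  }
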